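{- Let $\mathscr{P}$, $\mathscr{N}$, $\mathscr{L}$ be the infinite lower triangular matrices with entries, for $n\ge k\ge 0$, $$\mathscr{P}_{n,k}=\binom{n}{k},\qquad \mathscr{N}_{n,k}=\frac{1}{n+1}\binom{n+1}{k+1}\binom{n+1}{k},\qquad \mathscr{L}_{n,k}=\binom{n}{k}\frac{(n+1)!}{(k+1)!},$$ and $0$ for $k>n$. Then for every integer $j$, the matrix powers $\mathscr{P}^j$, $\mathscr{N}^j$, $\mathscr{L}^j$ all belong to $SDR_\infty$.
   Context: All matrices are infinite lower triangular matrices $\mathscr{A}=(A_{n,k})_{n\ge k\ge 0}$ with complex entries; we set $A_{n,k}=0$ whenever $k>n$. For an integer $m\ge 3$, $\mathscr{A}$ is called an SDR-matrix of order $m$ (written $\mathscr{A}\in SDR_m$) if for all integers $n,k\ge 0$, all $2\le p\le m-1$ and all $0\le r\le p-1$, $$\prod_{i=0}^{r}A_{n+i,k+r-i}\prod_{i=0}^{p-r-1}A_{n+p-i,k+r+i+1}=\prod_{i=0}^{r}A_{n+p-i,k+p-r+i}\prod_{i=0}^{p-r-1}A_{n+i,k+p-r-i-1}.$$ $SDR_\infty$ denotes the set of matrices lying in $SDR_m$ for every $m\ge 3$. $\mathscr{A}^0$ denotes the identity matrix and negative powers are powers of the matrix inverse. -}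

module Defs where

open import Data.Nat as ℕ using (ℕ; zero; suc; _∸_; _≤_; _≤?_)
open import Data.Nat.Combinatorics using (_C_)
open import Data.Nat.Properties using (_!≢0)
open import Data.Nat.Base using (_!)
open import Data.Integer as ℤ using (ℤ; +_; -[1+_])
open import Data.Rational using (ℚ; 0ℚ; 1ℚ; _+_; _*_; -_; _/_; 1/_; ≢-nonZero)
open import Data.Rational.Properties using (_≟_)
open import Data.List using (List; []; _∷_; _++_)
open import Relation.Nullary using (yes; no)

-- Infinite matrices, indexed (row n, column k), entries in ℚ.
Mat : Set
Mat = ℕ → ℕ → ℚ

lower : Mat → Mat
lower f n k with k ≤? n
... | yes _ = f n k
... | no  _ = 0ℚ

sumR : ℕ → (ℕ → ℚ) → ℚ
sumR zero    f = 0ℚ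
sumR (suc m) f = sumR m f + f m

prodR : ℕ → (ℕ → ℚ) → ℚ
prodR zero    f = 1ℚ
prodR (suc m) f = prodR m f * f m

-- Identity matrix and product of lower triangular matrices
-- (A B)_{n,k} = ∑_{i=0}^{n} A_{n,i} B_{i,k}  (all other terms vanish).
idM : Mat
idM n k with n ℕ.≟ k
... | yes _ = 1ℚ
... | no  _ = 0ℚ

_⊗_ : Mat → Mat → Mat
(A ⊗ B) n k = sumR (suc n) (λ i → A n i * B i k)

-- Reciprocal (only ever applied to nonzero diagonal entries; 0 ↦ 0 by convention).
recip : ℚ → ℚ
recip p with p ≟ 0ℚ
... | yes _ = 0ℚ
... | no  h = 1/_ p {{≢-nonZero h}}

nth : List ℚ → ℕ → ℚ
nth []       _       = 0ℚ
nth (x ∷ xs) zero    = x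
nth (x ∷ xs) (suc i) = nth xs i

sumIdx : List ℚ → (ℕ → ℚ) → ℚ
sumIdx []       g = 0ℚ
sumIdx (x ∷ xs) g = x * g 0 + sumIdx xs (λ e → g (suc e))

-- invRow A n d = [B_{n,n}, B_{n,n-1}, …, B_{n,n-d}] where B = A⁻¹, computed from
-- B A = I :  B_{n,k} A_{k,k} = - ∑_{i=k+1}^{n} B_{n,i} A_{i,k}.
invRow : Mat → ℕ → ℕ → List ℚ
invRow A n zero    = recip (A n n) ∷ []
invRow A n (suc d) =
  let v = invRow A n d
      k = n ∸ suc d
  in v ++ ((- sumIdx v (λ e → A (n ∸ e) k)) * recip (A k k) ∷ [])

inv : Mat → Mat
inv A n k with k ≤? n
... | yes _ = nth (invRow A n (n ∸ k)) (n ∸ k)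
... | no  _ = 0ℚ

powℕ : Mat → ℕ → Mat
powℕ A zero    = idM
powℕ A (suc m) = A ⊗ powℕ A m

powℤ : Mat → ℤ → Mat
powℤ A (+ m)    = powℕ A m
powℤ A -[1+ m ] = powℕ (inv A) (suc m)

SDR : ℕ → Mat → Set
SDR m A = ∀ (n k p r : ℕ) → 2 ≤ p → p ≤ m ∸ 1 → r ≤ p ∸ 1 →
  prodR (suc r) (λ i → A (n ℕ.+ i) ((k ℕ.+ r) ∸ i))
    * prodR (p ∸ r) (λ i → A ((n ℕ.+ p) ∸ i) (k ℕ.+ r ℕ.+ i ℕ.+ 1))
  ≡ prodR (suc r) (λ i → A ((n ℕ.+ p) ∸ i) (k ℕ.+ (p ∸ r) ℕ.+ i))
    * prodR (p ∸ r) (λ i → A (n ℕ.+ i) ((k ℕ.+ (p ∸ r)) ∸ suc i))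
  where open import Relation.Binary.PropositionalEquality using (_≡_)

SDR∞ : Mat → Set
SDR∞ A = ∀ (m : ℕ) → 3 ≤ m → SDR m A

ℕtoℚ : ℕ → ℚ
ℕtoℚ a = (+ a) / 1

Pascal : Mat
Pascal = lower (λ n k → ℕtoℚ (n C k))

Narayana : Mat
Narayana = lower (λ n k → (+ ((suc n C suc k) ℕ.* (suc n C k))) / suc n)

Lah : Mat
Lah = lower (λ n k → _/_ (+ ((n C k) ℕ.* (suc n) !)) ((suc k) !) {{(suc k) !≢0}})

-- A lower triangular matrix of the form  A n k = d n · c (n − k) · e k  (k ≤ n), a Toeplitz
-- matrix scaled by diagonal matrices on both sides, satisfies every SDR condition: the diagonal
-- factors on the two sides of an SDR identity run over the same rows and the same columns, and
-- the Toeplitz factors pair off because each depends only on n − k. When  e k · d k = 1  the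
-- matrix is  D T D⁻¹, so the form survives products and inverses, which act on c as convolution
-- and as the reciprocal power series. Pascal's matrix is  n! · 1/(n−k)! · 1/k!, the Narayana
-- matrix is  n!(n+1)! · 1/((n−k)!(n−k+1)!) · 1/(k!(k+1)!), and the Lah matrix is
-- n!(n+1)! · 1/(n−k)! · 1/(k!(k+1)!).
module Submission where

open import Defs
open import Data.Nat as ℕ using (ℕ; zero; suc; _+_; _∸_; _≤_; _<_; _≤?_; z≤n; s≤s; NonZero)
import Data.Nat.Properties as ℕP
open import Data.Nat.Base using (_!)
open import Data.Nat.Combinatorics using (_C_; nCk≡n!/k![n-k]!; k![n∸k]!∣n!)
open import Data.Nat.DivMod using (m/n*n≡m)
open import Data.Nat.Coprimality using (1-coprimeTo)
import Data.Nat.Coprimality as Coprimality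
import Data.Nat.Solver
open import Data.Integer as ℤ using (ℤ; -[1+_])
import Data.Integer.Properties as ℤP
open import Data.Rational using (ℚ; 0ℚ; 1ℚ; _*_; -_; _/_; mkℚ; ↥_) renaming (_+_ to _+ℚ_)
import Data.Rational as ℚ
import Data.Rational.Properties as ℚP
import Data.Rational.Unnormalised as ℚᵘ
import Data.Rational.Unnormalised.Properties as ℚᵘP
import Data.Rational.Solver
open import Data.List using (List; []; _∷_; _++_; length)
import Data.List.Properties as ListP
open import Data.Product using (_×_; _,_)
open import Data.Sum using (inj₁; inj₂)
open import Data.Empty using (⊥-elim)
open import Relation.Binary.PropositionalEquality
open import Relation.Nullary using (yes; no; Dec)

module ℕS = Data.Nat.Solver.+-*-Solver
module ℚS = Data.Rational.Solver.+-*-Solver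

recip-inverseˡ : ∀ p → p ≢ 0ℚ → recip p * p ≡ 1ℚ
recip-inverseˡ p p≢0 with p ℚP.≟ 0ℚ
... | yes p≡0 = ⊥-elim (p≢0 p≡0)
... | no p≢0′ = ℚP.*-inverseˡ p {{ℚ.≢-nonZero p≢0′}}

*≡1⇒≢0 : ∀ {x y} → x * y ≡ 1ℚ → x ≢ 0ℚ
*≡1⇒≢0 {y = y} xy≡1 refl = ℚP.1≢0 (trans (sym xy≡1) (ℚP.*-zeroˡ y))

recip-≢0 : ∀ p → p ≢ 0ℚ → recip p ≢ 0ℚ
recip-≢0 p p≢0 = *≡1⇒≢0 (recip-inverseˡ p p≢0)

recip-unique : ∀ x y → x * y ≡ 1ℚ → recip x ≡ y
recip-unique x y xy≡1 = begin
  recip x             ≡⟨ sym (ℚP.*-identityʳ (recip x)) ⟩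
  recip x * 1ℚ        ≡⟨ cong (recip x *_) (sym xy≡1) ⟩
  recip x * (x * y)   ≡⟨ sym (ℚP.*-assoc (recip x) x y) ⟩
  (recip x * x) * y   ≡⟨ cong (_* y) (recip-inverseˡ x (*≡1⇒≢0 xy≡1)) ⟩
  1ℚ * y              ≡⟨ ℚP.*-identityˡ y ⟩
  y                   ∎
  where open ≡-Reasoning

*-cancelʳ-≢0 : ∀ a b s → s ≢ 0ℚ → a * s ≡ b * s → a ≡ b
*-cancelʳ-≢0 a b s s≢0 as≡bs = begin
  a                   ≡⟨ divide a ⟩
  (a * s) * recip s   ≡⟨ cong (_* recip s) as≡bs ⟩
  (b * s) * recip s   ≡⟨ sym (divide b) ⟩
  b                   ∎
  where
  open ≡-Reasoning
  open ℚS
  divide : ∀ x → x ≡ (x * s) * recip s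
  divide x = begin
    x                   ≡⟨ sym (ℚP.*-identityʳ x) ⟩
    x * 1ℚ              ≡⟨ cong (x *_) (sym (recip-inverseˡ s s≢0)) ⟩
    x * (recip s * s)   ≡⟨ solve 3 (λ x u s → x :* (u :* s) := (x :* s) :* u) refl x (recip s) s ⟩
    (x * s) * recip s   ∎

*-zeroᵐ : ∀ x y → x * 0ℚ * y ≡ 0ℚ
*-zeroᵐ x y = trans (cong (_* y) (ℚP.*-zeroʳ x)) (ℚP.*-zeroˡ y)

prodR-cong : ∀ m {f g : ℕ → ℚ} → (∀ i → i < m → f i ≡ g i) → prodR m f ≡ prodR m g
prodR-cong zero    f≗g = refl
prodR-cong (suc m) f≗g =
  cong₂ _*_ (prodR-cong m (λ i i<m → f≗g i (ℕP.m<n⇒m<1+n i<m))) (f≗g m ℕP.≤-refl)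

prodR-*-distrib : ∀ m (f g : ℕ → ℚ) → prodR m (λ i → f i * g i) ≡ prodR m f * prodR m g
prodR-*-distrib zero    f g = refl
prodR-*-distrib (suc m) f g =
  trans (cong (_* (f m * g m)) (prodR-*-distrib m f g))
        (ℚS.solve 4 (λ a b c d → (a :* b) :* (c :* d) := (a :* c) :* (b :* d)) refl
                  (prodR m f) (prodR m g) (f m) (g m))
  where open ℚS

prodR-suc : ∀ m (f : ℕ → ℚ) → prodR (suc m) f ≡ f 0 * prodR m (λ i → f (suc i))
prodR-suc zero    f = trans (ℚP.*-identityˡ (f 0)) (sym (ℚP.*-identityʳ (f 0)))
prodR-suc (suc m) f = trans (cong (_* f (suc m)) (prodR-suc m f))
                            (ℚP.*-assoc (f 0) (prodR m (λ i → f (suc i))) (f (suc m)))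

prodR-+ : ∀ a b (f : ℕ → ℚ) → prodR (a + b) f ≡ prodR a f * prodR b (λ i → f (a + i))
prodR-+ a zero    f = trans (cong (λ x → prodR x f) (ℕP.+-identityʳ a)) (sym (ℚP.*-identityʳ _))
prodR-+ a (suc b) f = begin
  prodR (a + suc b) f                               ≡⟨ cong (λ x → prodR x f) (ℕP.+-suc a b) ⟩
  prodR (a + b) f * f (a + b)                       ≡⟨ cong (_* f (a + b)) (prodR-+ a b f) ⟩
  (prodR a f * prodR b (λ i → f (a + i))) * f (a + b) ≡⟨ ℚP.*-assoc (prodR a f) _ (f (a + b)) ⟩
  prodR a f * prodR (suc b) (λ i → f (a + i))       ∎
  where open ≡-Reasoning

prodR-+-comm : ∀ a b (f : ℕ → ℚ) →
  prodR a f * prodR b (λ i → f (a + i)) ≡ prodR b f * prodR a (λ i → f (b + i))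
prodR-+-comm a b f =
  trans (sym (prodR-+ a b f)) (trans (cong (λ x → prodR x f) (ℕP.+-comm a b)) (prodR-+ b a f))

prodR-reverse : ∀ m (f : ℕ → ℚ) → prodR m f ≡ prodR m (λ i → f (m ∸ suc i))
prodR-reverse zero    f = refl
prodR-reverse (suc m) f = begin
  prodR m f * f m                         ≡⟨ cong (_* f m) (prodR-reverse m f) ⟩
  prodR m (λ i → f (m ∸ suc i)) * f m     ≡⟨ ℚP.*-comm _ (f m) ⟩
  f m * prodR m (λ i → f (m ∸ suc i))     ≡⟨ sym (prodR-suc m (λ i → f (suc m ∸ suc i))) ⟩
  prodR (suc m) (λ i → f (suc m ∸ suc i)) ∎
  where open ≡-Reasoning

prodR-reverse-cong : ∀ m {f g : ℕ → ℚ} →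
  (∀ i → i < m → f (m ∸ suc i) ≡ g i) → prodR m f ≡ prodR m g
prodR-reverse-cong m {f} eq = trans (prodR-reverse m f) (prodR-cong m eq)

sumR-cong : ∀ m {f g : ℕ → ℚ} → (∀ i → i < m → f i ≡ g i) → sumR m f ≡ sumR m g
sumR-cong zero    f≗g = refl
sumR-cong (suc m) f≗g =
  cong₂ _+ℚ_ (sumR-cong m (λ i i<m → f≗g i (ℕP.m<n⇒m<1+n i<m))) (f≗g m ℕP.≤-refl)

sumR-zero : ∀ m (f : ℕ → ℚ) → (∀ i → i < m → f i ≡ 0ℚ) → sumR m f ≡ 0ℚ
sumR-zero m f f≗0 = trans (sumR-cong m f≗0) (sumR-const-0 m)
  where
  sumR-const-0 : ∀ m → sumR m (λ _ → 0ℚ) ≡ 0ℚ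
  sumR-const-0 zero    = refl
  sumR-const-0 (suc m) = cong (_+ℚ 0ℚ) (sumR-const-0 m)

sumR-suc : ∀ m (f : ℕ → ℚ) → sumR (suc m) f ≡ f 0 +ℚ sumR m (λ i → f (suc i))
sumR-suc zero    f = trans (ℚP.+-identityˡ (f 0)) (sym (ℚP.+-identityʳ (f 0)))
sumR-suc (suc m) f = trans (cong (_+ℚ f (suc m)) (sumR-suc m f))
                           (ℚP.+-assoc (f 0) (sumR m (λ i → f (suc i))) (f (suc m)))

sumR-+ : ∀ a b (f : ℕ → ℚ) → sumR (a + b) f ≡ sumR a f +ℚ sumR b (λ i → f (a + i))
sumR-+ a zero    f = trans (cong (λ x → sumR x f) (ℕP.+-identityʳ a)) (sym (ℚP.+-identityʳ _))
sumR-+ a (suc b) f = begin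
  sumR (a + suc b) f                                  ≡⟨ cong (λ x → sumR x f) (ℕP.+-suc a b) ⟩
  sumR (a + b) f +ℚ f (a + b)                         ≡⟨ cong (_+ℚ f (a + b)) (sumR-+ a b f) ⟩
  (sumR a f +ℚ sumR b (λ i → f (a + i))) +ℚ f (a + b) ≡⟨ ℚP.+-assoc (sumR a f) _ (f (a + b)) ⟩
  sumR a f +ℚ sumR (suc b) (λ i → f (a + i))          ∎
  where open ≡-Reasoning

sumR-*-distrib : ∀ m x y (f : ℕ → ℚ) → sumR m (λ i → x * f i * y) ≡ x * sumR m f * y
sumR-*-distrib zero    x y f = ℚS.solve 2 (λ x y → con 0ℚ := x :* con 0ℚ :* y) refl x y
  where open ℚS
sumR-*-distrib (suc m) x y f =
  trans (cong (_+ℚ (x * f m * y)) (sumR-*-distrib m x y f))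
        (ℚS.solve 4 (λ x y s a → x :* s :* y :+ x :* a :* y := x :* (s :+ a) :* y) refl
                  x y (sumR m f) (f m))
  where open ℚS

-- Lower triangular Toeplitz matrices

lower-≤ : ∀ f {n k} → k ≤ n → lower f n k ≡ f n k
lower-≤ f {n} {k} k≤n with k ≤? n
... | yes _   = refl
... | no  k≰n = ⊥-elim (k≰n k≤n)

lower-> : ∀ f {n k} → n < k → lower f n k ≡ 0ℚ
lower-> f {n} {k} n<k with k ≤? n
... | yes k≤n = ⊥-elim (ℕP.<⇒≱ n<k k≤n)
... | no  _   = refl

toeplitz : (ℕ → ℚ) → Mat
toeplitz c = lower (λ n k → c (n ∸ k))

toeplitz-≤ : ∀ c {n k} → k ≤ n → toeplitz c n k ≡ c (n ∸ k)
toeplitz-≤ c = lower-≤ (λ n k → c (n ∸ k))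

toeplitz-> : ∀ c {n k} → n < k → toeplitz c n k ≡ 0ℚ
toeplitz-> c = lower-> (λ n k → c (n ∸ k))

toeplitz-shift : ∀ c a b a′ b′ → a + b′ ≡ a′ + b → toeplitz c a b ≡ toeplitz c a′ b′
toeplitz-shift c a b a′ b′ eq with b ≤? a | b′ ≤? a′
... | yes _   | yes _   = cong c (begin
  a ∸ b                 ≡⟨ sym (ℕP.[m+n]∸[m+o]≡n∸o b′ a b) ⟩
  (b′ + a) ∸ (b′ + b)   ≡⟨ cong₂ _∸_ (trans (ℕP.+-comm b′ a) (trans eq (ℕP.+-comm a′ b)))
                                     (ℕP.+-comm b′ b) ⟩
  (b + a′) ∸ (b + b′)   ≡⟨ ℕP.[m+n]∸[m+o]≡n∸o b a′ b′ ⟩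
  a′ ∸ b′               ∎)
  where open ≡-Reasoning
... | yes b≤a | no b′≰a′ =
  ⊥-elim (ℕP.<-irrefl (trans (ℕP.+-comm b a′) (sym eq)) (ℕP.+-mono-≤-< b≤a (ℕP.≰⇒> b′≰a′)))
... | no b≰a  | yes b′≤a′ =
  ⊥-elim (ℕP.<-irrefl (trans (ℕP.+-comm b′ a) eq) (ℕP.+-mono-≤-< b′≤a′ (ℕP.≰⇒> b≰a)))
... | no _    | no _    = refl

[m+n]∸[n∸o]≡m+o : ∀ m {n o} → o ≤ n → (m + n) ∸ (n ∸ o) ≡ m + o
[m+n]∸[n∸o]≡m+o m {n} {o} o≤n =
  trans (ℕP.+-∸-assoc m (ℕP.m∸n≤m n o)) (cong (m +_) (ℕP.m∸[m∸n]≡n o≤n))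

suc[m∸suc[n]]≡m∸n : ∀ {m n} → n < m → suc (m ∸ suc n) ≡ m ∸ n
suc[m∸suc[n]]≡m∸n n<m = sym (ℕP.+-∸-assoc 1 n<m)

[n∸a]∸[n∸b]≡b∸a : ∀ {a b n} → a ≤ b → b ≤ n → (n ∸ a) ∸ (n ∸ b) ≡ b ∸ a
[n∸a]∸[n∸b]≡b∸a {a} {b} {n} a≤b b≤n = begin
  (n ∸ a) ∸ (n ∸ b)                         ≡⟨ cong (λ m → (m ∸ a) ∸ (m ∸ b)) (sym n≡b+[n∸b]) ⟩
  ((b + (n ∸ b)) ∸ a) ∸ ((b + (n ∸ b)) ∸ b) ≡⟨ cong₂ _∸_ (ℕP.+-∸-comm (n ∸ b) a≤b) (ℕP.m+n∸m≡n b (n ∸ b)) ⟩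
  ((b ∸ a) + (n ∸ b)) ∸ (n ∸ b)             ≡⟨ ℕP.m+n∸n≡m (b ∸ a) (n ∸ b) ⟩
  b ∸ a                                     ∎
  where
  open ≡-Reasoning
  n≡b+[n∸b] : b + (n ∸ b) ≡ n
  n≡b+[n∸b] = ℕP.m+[n∸m]≡n b≤n

-- The SDR identities

rowFactors-swap : ∀ (f : ℕ → ℚ) n r t →
  prodR (suc r) (λ i → f (n + i)) * prodR t (λ i → f ((n + (r + t)) ∸ i))
  ≡ prodR t (λ i → f (n + i)) * prodR (suc r) (λ i → f ((n + (r + t)) ∸ i))
rowFactors-swap f n r t = begin
  prodR (suc r) g * prodR t (λ i → f (N ∸ i))      ≡⟨ cong (prodR (suc r) g *_) lower-rows ⟩
  prodR (suc r) g * prodR t (λ i → g (suc r + i))  ≡⟨ prodR-+-comm (suc r) t g ⟩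
  prodR t g * prodR (suc r) (λ i → g (t + i))      ≡⟨ cong (prodR t g *_) (sym upper-rows) ⟩
  prodR t g * prodR (suc r) (λ i → f (N ∸ i))      ∎
  where
  open ≡-Reasoning
  open ℕS
  N = n + (r + t)
  g : ℕ → ℚ
  g i = f (n + i)
  lower-rows : prodR t (λ i → f (N ∸ i)) ≡ prodR t (λ i → g (suc r + i))
  lower-rows = prodR-reverse-cong t (λ i i<t → cong f (begin
    N ∸ (t ∸ suc i)           ≡⟨ cong (_∸ (t ∸ suc i)) (sym (ℕP.+-assoc n r t)) ⟩
    (n + r + t) ∸ (t ∸ suc i) ≡⟨ [m+n]∸[n∸o]≡m+o (n + r) i<t ⟩
    n + r + suc i             ≡⟨ solve 3 (λ n r i → n :+ r :+ (con 1 :+ i) := n :+ (con 1 :+ r :+ i)) refl n r i ⟩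
    n + (suc r + i)           ∎))
  upper-rows : prodR (suc r) (λ i → f (N ∸ i)) ≡ prodR (suc r) (λ i → g (t + i))
  upper-rows = prodR-reverse-cong (suc r) (λ i i≤r → cong f (begin
    N ∸ (r ∸ i)               ≡⟨ cong (_∸ (r ∸ i)) (solve 3 (λ n r t → n :+ (r :+ t) := n :+ t :+ r) refl n r t) ⟩
    (n + t + r) ∸ (r ∸ i)     ≡⟨ [m+n]∸[n∸o]≡m+o (n + t) (ℕP.≤-pred i≤r) ⟩
    n + t + i                 ≡⟨ ℕP.+-assoc n t i ⟩
    n + (t + i)               ∎))

columnFactors-swap : ∀ (f : ℕ → ℚ) k r t →
  prodR (suc r) (λ i → f ((k + r) ∸ i)) * prodR t (λ i → f (k + r + i + 1))
  ≡ prodR t (λ i → f ((k + t) ∸ suc i)) * prodR (suc r) (λ i → f (k + t + i))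
columnFactors-swap f k r t = begin
  prodR (suc r) (λ i → f ((k + r) ∸ i)) * prodR t (λ i → f (k + r + i + 1))
    ≡⟨ cong₂ _*_ left-columns right-columns ⟩
  prodR (suc r) g * prodR t (λ i → g (suc r + i))
    ≡⟨ prodR-+-comm (suc r) t g ⟩
  prodR t g * prodR (suc r) (λ i → g (t + i))
    ≡⟨ sym (cong₂ _*_ left-columns′ right-columns′) ⟩
  prodR t (λ i → f ((k + t) ∸ suc i)) * prodR (suc r) (λ i → f (k + t + i)) ∎
  where
  open ≡-Reasoning
  open ℕS
  g : ℕ → ℚ
  g i = f (k + i)
  left-columns : prodR (suc r) (λ i → f ((k + r) ∸ i)) ≡ prodR (suc r) g
  left-columns = prodR-reverse-cong (suc r) (λ i i≤r → cong f ([m+n]∸[n∸o]≡m+o k (ℕP.≤-pred i≤r)))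
  right-columns : prodR t (λ i → f (k + r + i + 1)) ≡ prodR t (λ i → g (suc r + i))
  right-columns = prodR-cong t (λ i _ → cong f
    (solve 3 (λ k r i → k :+ r :+ i :+ con 1 := k :+ (con 1 :+ r :+ i)) refl k r i))
  left-columns′ : prodR t (λ i → f ((k + t) ∸ suc i)) ≡ prodR t g
  left-columns′ = prodR-reverse-cong t (λ i i<t → cong f
    (trans (cong ((k + t) ∸_) (suc[m∸suc[n]]≡m∸n i<t)) ([m+n]∸[n∸o]≡m+o k (ℕP.<⇒≤ i<t))))
  right-columns′ : prodR (suc r) (λ i → f (k + t + i)) ≡ prodR (suc r) (λ i → g (t + i))
  right-columns′ = prodR-cong (suc r) (λ i _ → cong f (ℕP.+-assoc k t i))

module _ (c : ℕ → ℚ) (n k r t : ℕ) where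

  private
    N = n + (r + t)

  toeplitz-upperBlock :
    prodR (suc r) (λ i → toeplitz c (N ∸ i) (k + t + i))
    ≡ prodR (suc r) (λ i → toeplitz c (n + i) ((k + r) ∸ i))
  toeplitz-upperBlock = prodR-reverse-cong (suc r) (λ i i≤r →
    toeplitz-shift c _ _ (n + i) ((k + r) ∸ i) (begin
    (N ∸ (r ∸ i)) + ((k + r) ∸ i)
      ≡⟨ cong₂ _+_ (trans (cong (_∸ (r ∸ i)) N≡n+t+r) ([m+n]∸[n∸o]≡m+o (n + t) (ℕP.≤-pred i≤r)))
                   (ℕP.+-∸-assoc k (ℕP.≤-pred i≤r)) ⟩
    (n + t + i) + (k + (r ∸ i))
      ≡⟨ solve 5 (λ n t i k j → (n :+ t :+ i) :+ (k :+ j) := (n :+ i) :+ (k :+ t :+ j)) refl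
                 n t i k (r ∸ i) ⟩
    (n + i) + (k + t + (r ∸ i)) ∎))
    where
    open ≡-Reasoning
    open ℕS
    N≡n+t+r : N ≡ n + t + r
    N≡n+t+r = solve 3 (λ n r t → n :+ (r :+ t) := n :+ t :+ r) refl n r t

  toeplitz-lowerBlock :
    prodR t (λ i → toeplitz c (n + i) ((k + t) ∸ suc i))
    ≡ prodR t (λ i → toeplitz c (N ∸ i) (k + r + i + 1))
  toeplitz-lowerBlock = prodR-reverse-cong t (λ i i<t →
    toeplitz-shift c (n + (t ∸ suc i)) ((k + t) ∸ suc (t ∸ suc i)) _ _ (begin
    (n + (t ∸ suc i)) + (k + r + i + 1)
      ≡⟨ solve 5 (λ n j k r i → (n :+ j) :+ (k :+ r :+ i :+ con 1) := (n :+ r :+ (con 1 :+ j)) :+ (k :+ i))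
                 refl n (t ∸ suc i) k r i ⟩
    (n + r + suc (t ∸ suc i)) + (k + i)
      ≡⟨ sym (cong₂ _+_ (N∸i i<t) (trans (cong ((k + t) ∸_) (suc[m∸suc[n]]≡m∸n i<t))
                                         ([m+n]∸[n∸o]≡m+o k (ℕP.<⇒≤ i<t)))) ⟩
    (N ∸ i) + ((k + t) ∸ suc (t ∸ suc i)) ∎))
    where
    open ≡-Reasoning
    open ℕS
    N∸i : ∀ {i} → i < t → N ∸ i ≡ n + r + suc (t ∸ suc i)
    N∸i {i} i<t = begin
      N ∸ i               ≡⟨ cong (_∸ i) (sym (ℕP.+-assoc n r t)) ⟩
      (n + r + t) ∸ i     ≡⟨ ℕP.+-∸-assoc (n + r) (ℕP.<⇒≤ i<t) ⟩
      n + r + (t ∸ i)     ≡⟨ cong (n + r +_) (sym (suc[m∸suc[n]]≡m∸n i<t)) ⟩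
      n + r + suc (t ∸ suc i) ∎

ScaledToeplitz : (d e c : ℕ → ℚ) → Mat → Set
ScaledToeplitz d e c A = ∀ n k → A n k ≡ d n * toeplitz c n k * e k

module _ {d e c : ℕ → ℚ} {A : Mat} (A-form : ScaledToeplitz d e c A) where

  prodR-scaledToeplitz : ∀ m (f g : ℕ → ℕ) →
    prodR m (λ i → A (f i) (g i)) ≡
    prodR m (λ i → d (f i)) * prodR m (λ i → toeplitz c (f i) (g i)) * prodR m (λ i → e (g i))
  prodR-scaledToeplitz m f g = begin
    prodR m (λ i → A (f i) (g i))
      ≡⟨ prodR-cong m (λ i _ → A-form (f i) (g i)) ⟩
    prodR m (λ i → d (f i) * toeplitz c (f i) (g i) * e (g i))
      ≡⟨ prodR-*-distrib m _ (λ i → e (g i)) ⟩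
    prodR m (λ i → d (f i) * toeplitz c (f i) (g i)) * prodR m (λ i → e (g i))
      ≡⟨ cong (_* prodR m (λ i → e (g i))) (prodR-*-distrib m (λ i → d (f i)) _) ⟩
    prodR m (λ i → d (f i)) * prodR m (λ i → toeplitz c (f i) (g i)) * prodR m (λ i → e (g i)) ∎
    where open ≡-Reasoning

  scaledToeplitz-SDR-identity : ∀ n k r t →
    prodR (suc r) (λ i → A (n + i) ((k + r) ∸ i))
      * prodR t (λ i → A ((n + (r + t)) ∸ i) (k + r + i + 1))
    ≡ prodR (suc r) (λ i → A ((n + (r + t)) ∸ i) (k + t + i))
      * prodR t (λ i → A (n + i) ((k + t) ∸ suc i))
  scaledToeplitz-SDR-identity n k r t = begin
    prodR (suc r) (λ i → A (n + i) ((k + r) ∸ i)) * prodR t (λ i → A (N ∸ i) (k + r + i + 1))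
      ≡⟨ cong₂ _*_ (prodR-scaledToeplitz (suc r) _ _) (prodR-scaledToeplitz t _ _) ⟩
    (D₁ * T₁ * E₁) * (D₂ * T₂ * E₂)
      ≡⟨ regroup D₁ T₁ E₁ D₂ T₂ E₂ ⟩
    (D₁ * D₂) * (T₁ * T₂) * (E₁ * E₂)
      ≡⟨ cong₂ _*_ (cong₂ _*_ (rowFactors-swap d n r t)
                              (sym (cong₂ _*_ (toeplitz-upperBlock c n k r t) (toeplitz-lowerBlock c n k r t))))
                   (columnFactors-swap e k r t) ⟩
    (D₄ * D₃) * (T₃ * T₄) * (E₄ * E₃)
      ≡⟨ sym (trans (regroup D₃ T₃ E₃ D₄ T₄ E₄) swap-pairs) ⟩
    (D₃ * T₃ * E₃) * (D₄ * T₄ * E₄)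
      ≡⟨ sym (cong₂ _*_ (prodR-scaledToeplitz (suc r) _ _) (prodR-scaledToeplitz t _ _)) ⟩
    prodR (suc r) (λ i → A (N ∸ i) (k + t + i)) * prodR t (λ i → A (n + i) ((k + t) ∸ suc i)) ∎
    where
    open ≡-Reasoning
    N = n + (r + t)
    D₁ = prodR (suc r) (λ i → d (n + i))
    T₁ = prodR (suc r) (λ i → toeplitz c (n + i) ((k + r) ∸ i))
    E₁ = prodR (suc r) (λ i → e ((k + r) ∸ i))
    D₂ = prodR t (λ i → d (N ∸ i))
    T₂ = prodR t (λ i → toeplitz c (N ∸ i) (k + r + i + 1))
    E₂ = prodR t (λ i → e (k + r + i + 1))
    D₃ = prodR (suc r) (λ i → d (N ∸ i))
    T₃ = prodR (suc r) (λ i → toeplitz c (N ∸ i) (k + t + i))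
    E₃ = prodR (suc r) (λ i → e (k + t + i))
    D₄ = prodR t (λ i → d (n + i))
    T₄ = prodR t (λ i → toeplitz c (n + i) ((k + t) ∸ suc i))
    E₄ = prodR t (λ i → e ((k + t) ∸ suc i))
    regroup : ∀ a b c x y z → (a * b * c) * (x * y * z) ≡ (a * x) * (b * y) * (c * z)
    regroup = ℚS.solve 6 (λ a b c x y z → (a :* b :* c) :* (x :* y :* z)
                                       := (a :* x) :* (b :* y) :* (c :* z)) refl
      where open ℚS
    swap-pairs : (D₃ * D₄) * (T₃ * T₄) * (E₃ * E₄) ≡ (D₄ * D₃) * (T₃ * T₄) * (E₄ * E₃)
    swap-pairs = cong₂ _*_ (cong (_* (T₃ * T₄)) (ℚP.*-comm D₃ D₄)) (ℚP.*-comm E₃ E₄)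

  -- The identity holds for every p > r.
  scaledToeplitz⇒SDR : ∀ m → SDR m A
  scaledToeplitz⇒SDR m n k p r _ _ r≤p∸1 =
    subst SDR-identity r+[p∸r]≡p (scaledToeplitz-SDR-identity n k r (p ∸ r))
    where
    SDR-identity : ℕ → Set
    SDR-identity q = prodR (suc r) (λ i → A (n + i) ((k + r) ∸ i))
        * prodR (p ∸ r) (λ i → A ((n + q) ∸ i) (k + r + i + 1))
      ≡ prodR (suc r) (λ i → A ((n + q) ∸ i) (k + (p ∸ r) + i))
        * prodR (p ∸ r) (λ i → A (n + i) ((k + (p ∸ r)) ∸ suc i))
    r+[p∸r]≡p : r + (p ∸ r) ≡ p
    r+[p∸r]≡p = ℕP.m+[n∸m]≡n (ℕP.≤-trans r≤p∸1 (ℕP.m∸n≤m p 1))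

  scaledToeplitz⇒SDR∞ : SDR∞ A
  scaledToeplitz⇒SDR∞ m _ = scaledToeplitz⇒SDR m

-- Products and inverses

convolution : (ℕ → ℚ) → (ℕ → ℚ) → ℕ → ℚ
convolution c c′ m = sumR (suc m) (λ j → c (m ∸ j) * c′ j)

toeplitz-⊗ : ∀ c c′ n k → (toeplitz c ⊗ toeplitz c′) n k ≡ toeplitz (convolution c c′) n k
toeplitz-⊗ c c′ n k = by-cases (k ≤? n)
  where
  open ≡-Reasoning
  diagonal-offset : ∀ m → (toeplitz c ⊗ toeplitz c′) (k + m) k ≡ convolution c c′ ((k + m) ∸ k)
  diagonal-offset m = begin
    sumR (suc (k + m)) F                          ≡⟨ cong (λ x → sumR x F) (sym (ℕP.+-suc k m)) ⟩
    sumR (k + suc m) F                            ≡⟨ sumR-+ k (suc m) F ⟩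
    sumR k F +ℚ sumR (suc m) (λ j → F (k + j))    ≡⟨ cong₂ _+ℚ_ (sumR-zero k F above-diagonal)
                                                                  (sumR-cong (suc m) band) ⟩
    0ℚ +ℚ convolution c c′ m                      ≡⟨ ℚP.+-identityˡ _ ⟩
    convolution c c′ m                            ≡⟨ cong (convolution c c′) (sym (ℕP.m+n∸m≡n k m)) ⟩
    convolution c c′ ((k + m) ∸ k)                ∎
    where
    F : ℕ → ℚ
    F i = toeplitz c (k + m) i * toeplitz c′ i k
    above-diagonal : ∀ i → i < k → F i ≡ 0ℚ
    above-diagonal i i<k =
      trans (cong (toeplitz c (k + m) i *_) (toeplitz-> c′ i<k)) (ℚP.*-zeroʳ (toeplitz c (k + m) i))
    band : ∀ j → j < suc m → F (k + j) ≡ c (m ∸ j) * c′ j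
    band j j≤m = cong₂ _*_
      (trans (toeplitz-≤ c (ℕP.+-monoʳ-≤ k (ℕP.≤-pred j≤m))) (cong c (ℕP.[m+n]∸[m+o]≡n∸o k m j)))
      (trans (toeplitz-≤ c′ (ℕP.m≤m+n k j)) (cong c′ (ℕP.m+n∸m≡n k j)))
  by-cases : Dec (k ≤ n) → (toeplitz c ⊗ toeplitz c′) n k ≡ toeplitz (convolution c c′) n k
  by-cases (no k≰n) = trans
    (sumR-zero (suc n) _ (λ i i≤n →
      trans (cong (toeplitz c n i *_) (toeplitz-> c′ (ℕP.<-≤-trans i≤n (ℕP.≰⇒> k≰n))))
            (ℚP.*-zeroʳ (toeplitz c n i))))
    (sym (toeplitz-> (convolution c c′) (ℕP.≰⇒> k≰n)))
  by-cases (yes k≤n) = trans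
    (subst (λ n → (toeplitz c ⊗ toeplitz c′) n k ≡ convolution c c′ (n ∸ k))
           (ℕP.m+[n∸m]≡n k≤n) (diagonal-offset (n ∸ k)))
    (sym (toeplitz-≤ (convolution c c′) k≤n))

δ₀ : ℕ → ℚ
δ₀ zero    = 1ℚ
δ₀ (suc _) = 0ℚ

idM≡toeplitz-δ₀ : ∀ n k → idM n k ≡ toeplitz δ₀ n k
idM≡toeplitz-δ₀ n k with n ℕ.≟ k | k ≤? n
... | yes refl | yes _   = cong δ₀ (sym (ℕP.n∸n≡0 n))
... | yes refl | no n≰n  = ⊥-elim (n≰n ℕP.≤-refl)
... | no _     | no _    = refl
... | no n≢k   | yes k≤n with n ∸ k in n∸k≡
...   | suc _ = refl
...   | zero  = ⊥-elim (n≢k (ℕP.≤-antisym (ℕP.m∸n≡0⇒m≤n n∸k≡) k≤n))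

convolutionPower : (ℕ → ℚ) → ℕ → ℕ → ℚ
convolutionPower c zero    = δ₀
convolutionPower c (suc m) = convolution c (convolutionPower c m)

module _ {d e : ℕ → ℚ} (e*d≡1 : ∀ k → e k * d k ≡ 1ℚ) where

  scaledToeplitz-⊗ : ∀ {c c′ A B} → ScaledToeplitz d e c A → ScaledToeplitz d e c′ B →
    ScaledToeplitz d e (convolution c c′) (A ⊗ B)
  scaledToeplitz-⊗ {c} {c′} {A} {B} A-form B-form n k = begin
    sumR (suc n) (λ i → A n i * B i k)
      ≡⟨ sumR-cong (suc n) (λ i _ → term i) ⟩
    sumR (suc n) (λ i → d n * (toeplitz c n i * toeplitz c′ i k) * e k)
      ≡⟨ sumR-*-distrib (suc n) (d n) (e k) _ ⟩
    d n * (toeplitz c ⊗ toeplitz c′) n k * e k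
      ≡⟨ cong (λ x → d n * x * e k) (toeplitz-⊗ c c′ n k) ⟩
    d n * toeplitz (convolution c c′) n k * e k ∎
    where
    open ≡-Reasoning
    term : ∀ i → A n i * B i k ≡ d n * (toeplitz c n i * toeplitz c′ i k) * e k
    term i = begin
      A n i * B i k
        ≡⟨ cong₂ _*_ (A-form n i) (B-form i k) ⟩
      (d n * x * e i) * (d i * y * e k)
        ≡⟨ ℚS.solve 6 (λ a x ei di y ek → (a :* x :* ei) :* (di :* y :* ek)
                         := (a :* (x :* y) :* ek) :* (ei :* di)) refl (d n) x (e i) (d i) y (e k) ⟩
      (d n * (x * y) * e k) * (e i * d i)
        ≡⟨ cong ((d n * (x * y) * e k) *_) (e*d≡1 i) ⟩
      (d n * (x * y) * e k) * 1ℚ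
        ≡⟨ ℚP.*-identityʳ _ ⟩
      d n * (x * y) * e k ∎
      where
      open ℚS
      x = toeplitz c n i
      y = toeplitz c′ i k

  scaledToeplitz-idM : ScaledToeplitz d e δ₀ idM
  scaledToeplitz-idM n k = trans (idM-scaled n k) (cong (λ x → d n * x * e k) (idM≡toeplitz-δ₀ n k))
    where
    idM-scaled : ∀ n k → idM n k ≡ d n * idM n k * e k
    idM-scaled n k with n ℕ.≟ k
    ... | yes refl = sym (trans (cong (_* e n) (ℚP.*-identityʳ (d n)))
                                (trans (ℚP.*-comm (d n) (e n)) (e*d≡1 n)))
    ... | no _     = sym (*-zeroᵐ (d n) (e k))

  scaledToeplitz-powℕ : ∀ {A} c → ScaledToeplitz d e c A →
    ∀ m → ScaledToeplitz d e (convolutionPower c m) (powℕ A m)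
  scaledToeplitz-powℕ c A-form zero    = scaledToeplitz-idM
  scaledToeplitz-powℕ c A-form (suc m) =
    scaledToeplitz-⊗ {c = c} {c′ = convolutionPower c m} A-form (scaledToeplitz-powℕ c A-form m)

length-++-[] : ∀ (xs : List ℚ) x → length (xs ++ x ∷ []) ≡ suc (length xs)
length-++-[] xs x = trans (ListP.length-++ xs) (ℕP.+-comm (length xs) 1)

nth-++ˡ : ∀ (xs ys : List ℚ) {s} → s < length xs → nth (xs ++ ys) s ≡ nth xs s
nth-++ˡ (x ∷ xs) ys {zero}  _   = refl
nth-++ˡ (x ∷ xs) ys {suc s} s<n = nth-++ˡ xs ys (ℕP.≤-pred s<n)

nth-++-last : ∀ (xs : List ℚ) x {m} → length xs ≡ m → nth (xs ++ x ∷ []) m ≡ x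
nth-++-last []       x refl = refl
nth-++-last (y ∷ xs) x refl = nth-++-last xs x refl

sumIdx-sumR : ∀ v g → sumIdx v g ≡ sumR (length v) (λ s → nth v s * g s)
sumIdx-sumR []      g = refl
sumIdx-sumR (x ∷ v) g = trans (cong (x * g 0 +ℚ_) (sumIdx-sumR v (λ s → g (suc s))))
                              (sym (sumR-suc (length v) (λ s → nth (x ∷ v) s * g s)))

length-invRow : ∀ A n t → length (invRow A n t) ≡ suc t
length-invRow A n zero    = refl
length-invRow A n (suc t) = trans (length-++-[] (invRow A n t) _) (cong suc (length-invRow A n t))

-- The coefficients of the power series 1 / Σ c m xᵐ, by the recursion that defines invRow.
reciprocalList : (ℕ → ℚ) → ℕ → List ℚ
reciprocalList c zero    = recip (c 0) ∷ []
reciprocalList c (suc t) =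
  reciprocalList c t ++ ((- sumIdx (reciprocalList c t) (λ s → c (suc t ∸ s))) * recip (c 0) ∷ [])

reciprocal : (ℕ → ℚ) → ℕ → ℚ
reciprocal c t = nth (reciprocalList c t) t

length-reciprocalList : ∀ c t → length (reciprocalList c t) ≡ suc t
length-reciprocalList c zero    = refl
length-reciprocalList c (suc t) =
  trans (length-++-[] (reciprocalList c t) _) (cong suc (length-reciprocalList c t))

module _ {d e c : ℕ → ℚ} (e*d≡1 : ∀ k → e k * d k ≡ 1ℚ) (c₀≢0 : c 0 ≢ 0ℚ)
         {A : Mat} (A-form : ScaledToeplitz d e c A) where

  diagonal : ∀ k → A k k ≡ d k * c 0 * e k
  diagonal k = trans (A-form k k)
    (cong (λ x → d k * x * e k) (trans (toeplitz-≤ c (ℕP.≤-refl {k})) (cong c (ℕP.n∸n≡0 k))))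

  recip-diagonal : ∀ k → recip (A k k) ≡ d k * recip (c 0) * e k
  recip-diagonal k = recip-unique (A k k) _ (begin
    A k k * (d k * recip (c 0) * e k)
      ≡⟨ cong (_* (d k * recip (c 0) * e k)) (diagonal k) ⟩
    (d k * c 0 * e k) * (d k * recip (c 0) * e k)
      ≡⟨ ℚS.solve 4 (λ dk c₀ ek u → (dk :* c₀ :* ek) :* (dk :* u :* ek) := (ek :* dk) :* (ek :* dk) :* (u :* c₀))
                    refl (d k) (c 0) (e k) (recip (c 0)) ⟩
    (e k * d k) * (e k * d k) * (recip (c 0) * c 0)
      ≡⟨ cong₂ _*_ (cong₂ _*_ (e*d≡1 k) (e*d≡1 k)) (recip-inverseˡ (c 0) c₀≢0) ⟩
    1ℚ ∎)
    where
    open ≡-Reasoning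
    open ℚS

  RowInvariant : ℕ → ℕ → Set
  RowInvariant n t = ∀ s → s ≤ t → nth (invRow A n t) s ≡ d n * nth (reciprocalList c t) s * e (n ∸ s)

  invRow-pivotSum : ∀ {n t} → suc t ≤ n → RowInvariant n t →
    sumIdx (invRow A n t) (λ s → A (n ∸ s) (n ∸ suc t))
    ≡ d n * sumIdx (reciprocalList c t) (λ s → c (suc t ∸ s)) * e (n ∸ suc t)
  invRow-pivotSum {n} {t} t<n row = begin
    sumIdx v (λ s → A (n ∸ s) k)
      ≡⟨ sumIdx-sumR v _ ⟩
    sumR (length v) (λ s → nth v s * A (n ∸ s) k)
      ≡⟨ cong (λ m → sumR m (λ s → nth v s * A (n ∸ s) k)) (length-invRow A n t) ⟩
    sumR (suc t) (λ s → nth v s * A (n ∸ s) k)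
      ≡⟨ sumR-cong (suc t) term ⟩
    sumR (suc t) (λ s → d n * (nth w s * c (suc t ∸ s)) * e k)
      ≡⟨ sumR-*-distrib (suc t) (d n) (e k) _ ⟩
    d n * sumR (suc t) (λ s → nth w s * c (suc t ∸ s)) * e k
      ≡⟨ cong (λ m → d n * sumR m (λ s → nth w s * c (suc t ∸ s)) * e k) (sym (length-reciprocalList c t)) ⟩
    d n * sumR (length w) (λ s → nth w s * c (suc t ∸ s)) * e k
      ≡⟨ cong (λ z → d n * z * e k) (sym (sumIdx-sumR w _)) ⟩
    d n * sumIdx w (λ s → c (suc t ∸ s)) * e k ∎
    where
    open ≡-Reasoning
    v = invRow A n t
    w = reciprocalList c t
    k = n ∸ suc t
    term : ∀ s → s < suc t → nth v s * A (n ∸ s) k ≡ d n * (nth w s * c (suc t ∸ s)) * e k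
    term s s≤t = begin
      nth v s * A (n ∸ s) k
        ≡⟨ cong₂ _*_ (row s (ℕP.≤-pred s≤t)) (A-form (n ∸ s) k) ⟩
      (d n * nth w s * e (n ∸ s)) * (d (n ∸ s) * toeplitz c (n ∸ s) k * e k)
        ≡⟨ cong (λ z → (d n * nth w s * e (n ∸ s)) * (d (n ∸ s) * z * e k)) pivot-column ⟩
      (d n * nth w s * e (n ∸ s)) * (d (n ∸ s) * c (suc t ∸ s) * e k)
        ≡⟨ ℚS.solve 6 (λ dn W es ds C ek → (dn :* W :* es) :* (ds :* C :* ek)
                                          := (dn :* (W :* C) :* ek) :* (es :* ds))
                      refl (d n) (nth w s) (e (n ∸ s)) (d (n ∸ s)) (c (suc t ∸ s)) (e k) ⟩
      (d n * (nth w s * c (suc t ∸ s)) * e k) * (e (n ∸ s) * d (n ∸ s))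
        ≡⟨ cong ((d n * (nth w s * c (suc t ∸ s)) * e k) *_) (e*d≡1 (n ∸ s)) ⟩
      (d n * (nth w s * c (suc t ∸ s)) * e k) * 1ℚ
        ≡⟨ ℚP.*-identityʳ _ ⟩
      d n * (nth w s * c (suc t ∸ s)) * e k ∎
      where
      open ℚS
      s≤1+t : s ≤ suc t
      s≤1+t = ℕP.<⇒≤ s≤t
      pivot-column : toeplitz c (n ∸ s) k ≡ c (suc t ∸ s)
      pivot-column = trans (toeplitz-≤ c (ℕP.∸-monoʳ-≤ n s≤1+t)) (cong c ([n∸a]∸[n∸b]≡b∸a s≤1+t t<n))

  invRow-newEntry : ∀ {n t} → suc t ≤ n → RowInvariant n t →
    nth (invRow A n (suc t)) (suc t) ≡ d n * nth (reciprocalList c (suc t)) (suc t) * e (n ∸ suc t)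
  invRow-newEntry {n} {t} t<n row = begin
    nth (invRow A n t ++ x ∷ []) (suc t)
      ≡⟨ nth-++-last (invRow A n t) x (length-invRow A n t) ⟩
    x
      ≡⟨ cong₂ (λ a b → (- a) * b) (invRow-pivotSum t<n row) (recip-diagonal k) ⟩
    (- (d n * S * e k)) * (d k * recip (c 0) * e k)
      ≡⟨ ℚS.solve 5 (λ dn S ek dk u → (:- (dn :* S :* ek)) :* (dk :* u :* ek)
                                     := (dn :* ((:- S) :* u) :* ek) :* (ek :* dk))
                    refl (d n) S (e k) (d k) (recip (c 0)) ⟩
    (d n * y * e k) * (e k * d k)
      ≡⟨ cong ((d n * y * e k) *_) (e*d≡1 k) ⟩
    (d n * y * e k) * 1ℚ
      ≡⟨ ℚP.*-identityʳ _ ⟩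
    d n * y * e k
      ≡⟨ cong (λ z → d n * z * e k) (sym (nth-++-last (reciprocalList c t) y (length-reciprocalList c t))) ⟩
    d n * nth (reciprocalList c t ++ y ∷ []) (suc t) * e k ∎
    where
    open ≡-Reasoning
    open ℚS
    k = n ∸ suc t
    x = (- sumIdx (invRow A n t) (λ s → A (n ∸ s) k)) * recip (A k k)
    S = sumIdx (reciprocalList c t) (λ s → c (suc t ∸ s))
    y = (- S) * recip (c 0)

  invRow-scaledToeplitz : ∀ n t → t ≤ n → RowInvariant n t
  invRow-scaledToeplitz n zero    _   .zero z≤n = recip-diagonal n
  invRow-scaledToeplitz n (suc t) t<n s s≤1+t with ℕP.m≤n⇒m<n∨m≡n s≤1+t
  ... | inj₂ refl = invRow-newEntry t<n (invRow-scaledToeplitz n t (ℕP.<⇒≤ t<n))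
  ... | inj₁ s≤t  = begin
    nth (invRow A n t ++ _) s
      ≡⟨ nth-++ˡ (invRow A n t) _ (subst (s <_) (sym (length-invRow A n t)) s≤t) ⟩
    nth (invRow A n t) s
      ≡⟨ invRow-scaledToeplitz n t (ℕP.<⇒≤ t<n) s (ℕP.≤-pred s≤t) ⟩
    d n * nth (reciprocalList c t) s * e (n ∸ s)
      ≡⟨ cong (λ x → d n * x * e (n ∸ s))
              (sym (nth-++ˡ (reciprocalList c t) _ (subst (s <_) (sym (length-reciprocalList c t)) s≤t))) ⟩
    d n * nth (reciprocalList c (suc t)) s * e (n ∸ s) ∎
    where open ≡-Reasoning

  scaledToeplitz-inv : ScaledToeplitz d e (reciprocal c) (inv A)
  scaledToeplitz-inv n k with k ≤? n
  ... | yes k≤n = trans (invRow-scaledToeplitz n (n ∸ k) (ℕP.m∸n≤m n k) (n ∸ k) ℕP.≤-refl)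
                        (cong (λ z → d n * reciprocal c (n ∸ k) * e z) (ℕP.m∸[m∸n]≡n k≤n))
  ... | no _    = sym (*-zeroᵐ (d n) (e k))

scaledToeplitz⇒SDR∞-powℤ : ∀ d e c {A} → ScaledToeplitz d e c A →
  (∀ k → e k * d k ≡ 1ℚ) → c 0 ≢ 0ℚ → ∀ j → SDR∞ (powℤ A j)
scaledToeplitz⇒SDR∞-powℤ d e c A-form e*d≡1 c₀≢0 (ℤ.+ m) =
  scaledToeplitz⇒SDR∞ {d} {e} {convolutionPower c m} (scaledToeplitz-powℕ {d} {e} e*d≡1 c A-form m)
scaledToeplitz⇒SDR∞-powℤ d e c A-form e*d≡1 c₀≢0 -[1+ m ] =
  scaledToeplitz⇒SDR∞ {d} {e} {convolutionPower (reciprocal c) (suc m)}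
    (scaledToeplitz-powℕ {d} {e} e*d≡1 (reciprocal c) (scaledToeplitz-inv {d} {e} {c} e*d≡1 c₀≢0 A-form) (suc m))

instance
  *-nonZero : ∀ {m n} {{_ : NonZero m}} {{_ : NonZero n}} → NonZero (m ℕ.* n)
  *-nonZero {m} {n} = ℕP.m*n≢0 m n

ℕtoℚ≡mkℚ : ∀ a → ℕtoℚ a ≡ mkℚ (ℤ.+ a) 0 (Coprimality.sym (1-coprimeTo a))
ℕtoℚ≡mkℚ a = ℚP.normalize-coprime (Coprimality.sym (1-coprimeTo a))

ℕtoℚ-* : ∀ a b → ℕtoℚ a * ℕtoℚ b ≡ ℕtoℚ (a ℕ.* b)
ℕtoℚ-* a b rewrite ℕtoℚ≡mkℚ a | ℕtoℚ≡mkℚ b = cong (_/ 1) (sym (ℤP.pos-* a b))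

ℕtoℚ-≢0 : ∀ b .{{_ : NonZero b}} → ℕtoℚ b ≢ 0ℚ
ℕtoℚ-≢0 (suc b) eq with () ← trans (sym (cong ↥_ (ℕtoℚ≡mkℚ (suc b)))) (cong ↥_ eq)

recip-ℕtoℚ-inverseˡ : ∀ m .{{_ : NonZero m}} → recip (ℕtoℚ m) * ℕtoℚ m ≡ 1ℚ
recip-ℕtoℚ-inverseˡ m = recip-inverseˡ (ℕtoℚ m) (ℕtoℚ-≢0 m)

[+a/b]*b≡a : ∀ a b .{{_ : NonZero b}} → ((ℤ.+ a) / b) * ℕtoℚ b ≡ ℕtoℚ a
[+a/b]*b≡a a (suc b) = ℚP.toℚᵘ-injective (begin
  ℚ.toℚᵘ ((ℤ.+ a) / suc b * ℕtoℚ (suc b))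
    ≈⟨ ℚP.toℚᵘ-homo-* ((ℤ.+ a) / suc b) (ℕtoℚ (suc b)) ⟩
  ℚ.toℚᵘ ((ℤ.+ a) / suc b) ℚᵘ.* ℚ.toℚᵘ (ℕtoℚ (suc b))
    ≈⟨ ℚᵘP.*-cong (ℚP.toℚᵘ-fromℚᵘ (ℚᵘ.mkℚᵘ (ℤ.+ a) b)) (ℚP.toℚᵘ-fromℚᵘ (ℚᵘ.mkℚᵘ (ℤ.+ suc b) 0)) ⟩
  ℚᵘ.mkℚᵘ (ℤ.+ a) b ℚᵘ.* ℚᵘ.mkℚᵘ (ℤ.+ suc b) 0
    ≈⟨ ℚᵘ.*≡* (trans (ℤP.*-identityʳ _) (cong (λ z → (ℤ.+ a) ℤ.* (ℤ.+ suc z)) (sym (ℕP.*-identityʳ b)))) ⟩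
  ℚᵘ.mkℚᵘ (ℤ.+ a) 0
    ≈⟨ ℚᵘP.≃-sym (ℚP.toℚᵘ-fromℚᵘ (ℚᵘ.mkℚᵘ (ℤ.+ a) 0)) ⟩
  ℚ.toℚᵘ (ℕtoℚ a) ∎)
  where open ℚᵘP.≃-Reasoning

/-cross-multiply : ∀ a q D K M .{{_ : NonZero q}} .{{_ : NonZero K}} .{{_ : NonZero M}} →
  a ℕ.* (K ℕ.* M) ≡ q ℕ.* D → (ℤ.+ a) / q ≡ ℕtoℚ D * recip (ℕtoℚ M) * recip (ℕtoℚ K)
/-cross-multiply a q D K M aKM≡qD = *-cancelʳ-≢0 x _ s s≢0 (begin
  x * s                                           ≡⟨ sym (ℚP.*-assoc x (ℕtoℚ q) (ℕtoℚ K * ℕtoℚ M)) ⟩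
  (x * ℕtoℚ q) * (ℕtoℚ K * ℕtoℚ M)                ≡⟨ cong₂ _*_ ([+a/b]*b≡a a q) (ℕtoℚ-* K M) ⟩
  ℕtoℚ a * ℕtoℚ (K ℕ.* M)                         ≡⟨ ℕtoℚ-* a (K ℕ.* M) ⟩
  ℕtoℚ (a ℕ.* (K ℕ.* M))                          ≡⟨ cong ℕtoℚ aKM≡qD ⟩
  ℕtoℚ (q ℕ.* D)                                  ≡⟨ sym (ℕtoℚ-* q D) ⟩
  ℕtoℚ q * ℕtoℚ D                                 ≡⟨ solve 2 (λ u v → u :* v := u :* v :* con 1ℚ :* con 1ℚ) refl
                                                                (ℕtoℚ q) (ℕtoℚ D) ⟩
  ℕtoℚ q * ℕtoℚ D * 1ℚ * 1ℚ                       ≡⟨ sym (cong₂ (λ u v → ℕtoℚ q * ℕtoℚ D * u * v)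
                                                          (recip-ℕtoℚ-inverseˡ M) (recip-ℕtoℚ-inverseˡ K)) ⟩
  ℕtoℚ q * ℕtoℚ D * (recip (ℕtoℚ M) * ℕtoℚ M) * (recip (ℕtoℚ K) * ℕtoℚ K)
    ≡⟨ solve 6 (λ q D m u k v → q :* D :* (u :* m) :* (v :* k) := D :* u :* v :* (q :* (k :* m)))
                  refl (ℕtoℚ q) (ℕtoℚ D) (ℕtoℚ M) (recip (ℕtoℚ M)) (ℕtoℚ K) (recip (ℕtoℚ K)) ⟩
  ℕtoℚ D * recip (ℕtoℚ M) * recip (ℕtoℚ K) * s   ∎)
  where
  open ≡-Reasoning
  open ℚS
  x = (ℤ.+ a) / q
  s = ℕtoℚ q * (ℕtoℚ K * ℕtoℚ M)
  s≢0 : s ≢ 0ℚ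
  s≢0 = subst (_≢ 0ℚ) (sym (trans (cong (ℕtoℚ q *_) (ℕtoℚ-* K M)) (ℕtoℚ-* q (K ℕ.* M))))
              (ℕtoℚ-≢0 (q ℕ.* (K ℕ.* M)))

-- The Pascal, Narayana and Lah matrices

binomial-factorials : ∀ {n k} → k ≤ n → (n C k) ℕ.* (k ! ℕ.* (n ∸ k) !) ≡ n !
binomial-factorials {n} {k} k≤n =
  trans (cong (ℕ._* (k ! ℕ.* (n ∸ k) !)) (nCk≡n!/k![n-k]! k≤n))
        (m/n*n≡m {{ℕP._!*_!≢0 k (n ∸ k)}} (k![n∸k]!∣n! k≤n))

lower-scaledToeplitz : ∀ d e c {f} → (∀ {n k} → k ≤ n → f n k ≡ d n * c (n ∸ k) * e k) →
  ScaledToeplitz d e c (lower f)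
lower-scaledToeplitz d e c entry n k with k ≤? n
... | yes k≤n = entry k≤n
... | no  _   = sym (*-zeroᵐ (d n) (e k))

asℚ : (ℕ → ℕ) → ℕ → ℚ
asℚ D n = ℕtoℚ (D n)

recipℚ : (ℕ → ℕ) → ℕ → ℚ
recipℚ D n = recip (ℕtoℚ (D n))

factorialPair : ℕ → ℕ
factorialPair n = n ! ℕ.* (suc n) !

-- Deliberately not an instance: instance search would try to unfold factorials.
factorialPair-nonZero : ∀ n → NonZero (factorialPair n)
factorialPair-nonZero n = ℕP._!*_!≢0 n (suc n)

pascal-scaledToeplitz : ScaledToeplitz (asℚ _!) (recipℚ _!) (recipℚ _!) Pascal
pascal-scaledToeplitz = lower-scaledToeplitz (asℚ _!) (recipℚ _!) (recipℚ _!) λ {n} {k} k≤n →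
  /-cross-multiply (n C k) 1 (n !) (k !) ((n ∸ k) !) {{_}} {{k ℕP.!≢0}} {{(n ∸ k) ℕP.!≢0}}
    (trans (binomial-factorials k≤n) (sym (ℕP.*-identityˡ (n !))))

narayana-scaledToeplitz :
  ScaledToeplitz (asℚ factorialPair) (recipℚ factorialPair) (recipℚ factorialPair) Narayana
narayana-scaledToeplitz =
  lower-scaledToeplitz (asℚ factorialPair) (recipℚ factorialPair) (recipℚ factorialPair) λ {n} {k} k≤n →
  /-cross-multiply ((suc n C suc k) ℕ.* (suc n C k)) (suc n)
                   (factorialPair n) (factorialPair k) (factorialPair (n ∸ k))
    {{_}} {{factorialPair-nonZero k}} {{factorialPair-nonZero (n ∸ k)}} (begin
    ((suc n C suc k) ℕ.* (suc n C k)) ℕ.* (factorialPair k ℕ.* factorialPair (n ∸ k))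
      ≡⟨ solve 6 (λ c₁ c₂ a b u w → (c₁ :* c₂) :* ((a :* b) :* (u :* w))
                                 := (c₁ :* (b :* u)) :* (c₂ :* (a :* w)))
                 refl (suc n C suc k) (suc n C k) (k !) ((suc k) !) ((n ∸ k) !) ((suc (n ∸ k)) !) ⟩
    ((suc n C suc k) ℕ.* ((suc k) ! ℕ.* (n ∸ k) !)) ℕ.* ((suc n C k) ℕ.* (k ! ℕ.* (suc (n ∸ k)) !))
      ≡⟨ cong₂ ℕ._*_ (binomial-factorials (s≤s k≤n))
                     (trans (cong (λ z → (suc n C k) ℕ.* (k ! ℕ.* z !)) (sym (ℕP.+-∸-assoc 1 k≤n)))
                            (binomial-factorials (ℕP.m≤n⇒m≤1+n k≤n))) ⟩
    (suc n) ! ℕ.* (suc n) !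
      ≡⟨ ℕP.*-assoc (suc n) (n !) ((suc n) !) ⟩
    suc n ℕ.* factorialPair n ∎)
  where
  open ≡-Reasoning
  open ℕS

lah-scaledToeplitz : ScaledToeplitz (asℚ factorialPair) (recipℚ factorialPair) (recipℚ _!) Lah
lah-scaledToeplitz =
  lower-scaledToeplitz (asℚ factorialPair) (recipℚ factorialPair) (recipℚ _!) λ {n} {k} k≤n →
  /-cross-multiply ((n C k) ℕ.* (suc n) !) ((suc k) !) (factorialPair n) (factorialPair k) ((n ∸ k) !)
    {{(suc k) ℕP.!≢0}} {{factorialPair-nonZero k}} {{(n ∸ k) ℕP.!≢0}} (begin
    ((n C k) ℕ.* (suc n) !) ℕ.* (factorialPair k ℕ.* (n ∸ k) !)
      ≡⟨ solve 5 (λ c s x y u → (c :* s) :* ((x :* y) :* u) := (c :* (x :* u)) :* (y :* s))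
                 refl (n C k) ((suc n) !) (k !) ((suc k) !) ((n ∸ k) !) ⟩
    ((n C k) ℕ.* (k ! ℕ.* (n ∸ k) !)) ℕ.* ((suc k) ! ℕ.* (suc n) !)
      ≡⟨ cong (ℕ._* ((suc k) ! ℕ.* (suc n) !)) (binomial-factorials k≤n) ⟩
    n ! ℕ.* ((suc k) ! ℕ.* (suc n) !)
      ≡⟨ solve 3 (λ x y z → x :* (y :* z) := y :* (x :* z)) refl (n !) ((suc k) !) ((suc n) !) ⟩
    (suc k) ! ℕ.* factorialPair n ∎)
  where
  open ≡-Reasoning
  open ℕS

corollary2p1 : ∀ (j : ℤ) →
    SDR∞ (powℤ Pascal j) × SDR∞ (powℤ Narayana j) × SDR∞ (powℤ Lah j)
corollary2p1 j =
    scaledToeplitz⇒SDR∞-powℤ (asℚ _!) (recipℚ _!) (recipℚ _!)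
      pascal-scaledToeplitz factorials-inverse c₀≢0 j
  , scaledToeplitz⇒SDR∞-powℤ (asℚ factorialPair) (recipℚ factorialPair) (recipℚ factorialPair)
      narayana-scaledToeplitz factorialPairs-inverse c₀≢0 j
  , scaledToeplitz⇒SDR∞-powℤ (asℚ factorialPair) (recipℚ factorialPair) (recipℚ _!)
      lah-scaledToeplitz factorialPairs-inverse c₀≢0 j
  where
  factorials-inverse : ∀ k → recipℚ _! k * asℚ _! k ≡ 1ℚ
  factorials-inverse k = recip-ℕtoℚ-inverseˡ (k !) {{k ℕP.!≢0}}
  factorialPairs-inverse : ∀ k → recipℚ factorialPair k * asℚ factorialPair k ≡ 1ℚ
  factorialPairs-inverse k = recip-ℕtoℚ-inverseˡ (factorialPair k) {{factorialPair-nonZero k}}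
  c₀≢0 : recipℚ _! 0 ≢ 0ℚ
  c₀≢0 = recip-≢0 (ℕtoℚ 1) (ℕtoℚ-≢0 1)
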